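{- Let $(g,f_1,f_2)$ and $(u,v_1,v_2)$ be Sprugnoli arrays. Then the power series $$\frac{1}{x}\cdot\frac{(g,f_1,f_2)\cdot\big(x\,u(x)v_2(x)\big)}{(g,f_1,f_2)\cdot u(x)}$$ is odd (contains only odd powers of $x$).
   Context: All power series are formal power series over a field $\mathbb{K}$ of characteristic $0$. $\mathcal{F}_r$ denotes the set of power series $\sum_{n\ge r}a_nx^n$ with $a_r\ne0$. A Sprugnoli array is a triple $(g,f_1,f_2)$ with $g\in\mathcal{F}_0$, $f_1\in\mathcal{F}_1$, $f_2\in\mathcal{F}_1$ and $f_2$ odd (only odd powers of $x$); its matrix is the lower-triangular matrix $(t_{n,k})_{n,k\ge0}$ with $t_{n,k}=[x^n]\,g(x)f_1(x)^{k\bmod 2}(xf_2(x))^{\lfloor k/2\rfloor}$. For a power series $h=\sum_n a_nx^n$, $(g,f_1,f_2)\cdot h$ denotes the power series $\sum_n\left(\sum_k t_{n,k}a_k\right)x^n$. (Here $(g,f_1,f_2)\cdot u\in\mathcal{F}_0$, so the quotient is a power series.) -}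

module Defs where

open import Level using (Level; _⊔_) renaming (suc to lsuc)
open import Algebra.Bundles using (CommutativeRing)
open import Data.Nat using (ℕ; zero; suc; _<_; _∸_; _%_; _/_) renaming (_*_ to _*ℕ_)
open import Data.List using (List; []; _∷_; _++_)
open import Data.Product using (_×_)
open import Relation.Nullary using (¬_)
open import Relation.Binary.PropositionalEquality using (_≡_)

-- A field: a commutative ring with 0 ≠ 1 in which every nonzero element has an
-- inverse.  The inverse is a total function (its value at 0 is irrelevant).
record Field (c ℓ : Level) : Set (lsuc (c ⊔ ℓ)) where
  field
    commutativeRing : CommutativeRing c ℓ
  open CommutativeRing commutativeRing public
  field
    _⁻¹        : Carrier → Carrier
    ⁻¹-inverse : ∀ x → ¬ (x ≈ 0#) → x * (x ⁻¹) ≈ 1#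
    0≉1        : ¬ (0# ≈ 1#)

module _ {c ℓ : Level} (F : Field c ℓ) where
  open Field F

  natMul : ℕ → Carrier
  natMul zero    = 0#
  natMul (suc n) = 1# + natMul n

  CharZero : Set ℓ
  CharZero = ∀ n → ¬ (natMul (suc n) ≈ 0#)

module PowerSeries {c ℓ : Level} (F : Field c ℓ) where
  open Field F

  Series : Set c
  Series = ℕ → Carrier

  Σ< : ℕ → (ℕ → Carrier) → Carrier
  Σ< zero    f = 0#
  Σ< (suc n) f = Σ< n f + f n

  _⊛_ : Series → Series → Series
  (a ⊛ b) n = Σ< (suc n) (λ k → a k * b (n ∸ k))

  one : Series
  one zero    = 1#
  one (suc n) = 0#

  X : Series
  X (suc zero) = 1#
  X _          = 0#

  pow : Series → ℕ → Series
  pow a zero    = one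
  pow a (suc k) = a ⊛ pow a k

  InF : ℕ → Series → Set ℓ
  InF r a = (∀ n → n < r → a n ≈ 0#) × ¬ (a r ≈ 0#)

  OddSeries : Series → Set ℓ
  OddSeries a = ∀ m → a (2 *ℕ m) ≈ 0#

  IsSprugnoli : Series → Series → Series → Set ℓ
  IsSprugnoli g f₁ f₂ = InF 0 g × InF 1 f₁ × InF 1 f₂ × OddSeries f₂

  -- column k of the matrix: g f₁^(k mod 2) (x f₂)^⌊k/2⌋ ; t n k = [x^n] column k
  column : Series → Series → Series → ℕ → Series
  column g f₁ f₂ k = g ⊛ (pow f₁ (k % 2) ⊛ pow (X ⊛ f₂) (k / 2))

  entry : Series → Series → Series → ℕ → ℕ → Carrier
  entry g f₁ f₂ n k = column g f₁ f₂ k n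

  -- (g,f₁,f₂) · h ; the sum over k is truncated at k ≤ n since t n k = 0 for k > n
  -- (column k has order k because g ∈ 𝓕₀, f₁ ∈ 𝓕₁, x f₂ ∈ 𝓕₂)
  act : Series → Series → Series → Series → Series
  act g f₁ f₂ h n = Σ< (suc n) (λ k → entry g f₁ f₂ n k * h k)

  nth : List Carrier → ℕ → Carrier
  nth []       _       = 0#
  nth (q ∷ qs) zero    = q
  nth (q ∷ qs) (suc k) = nth qs k

  -- quotient N / D (for D with invertible constant term):
  -- q_n = D₀⁻¹ (N_n - Σ_{k<n} q_k D_{n-k})
  divPrefix : Series → Series → ℕ → List Carrier
  divPrefix N D zero    = []
  divPrefix N D (suc n) =
    let qs = divPrefix N D n in
    qs ++ ((D 0 ⁻¹) * (N n - Σ< n (λ k → nth qs k * D (n ∸ k))) ∷ [])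

  _÷_ : Series → Series → Series
  (N ÷ D) n = nth (divPrefix N D (suc n)) n

  -- (1/x) · h  (used only for h with zero constant term)
  shift : Series → Series
  shift h n = h (suc n)

-- Put Y = x f₂ and V = x v₂; both are even because f₂ and v₂ are odd.  For
-- even i the i-th column of (1, f₁, f₂) is Y^(i/2), and multiplying the j-th
-- column of (g, f₁, f₂) by Y^q gives its (2q + j)-th column.  Since V only has
-- even coefficients, this yields the factorisation
--   (g, f₁, f₂) · (V u) = ((1, f₁, f₂) · V) · ((g, f₁, f₂) · u),
-- so the quotient in the theorem is x⁻¹ ((1, f₁, f₂) · V).  That series is a
-- combination of the even series Y^q, hence even, and dividing by x makes it odd.
module Submission where

open import Defs
open import Level using (Level)
open import Data.Nat
  using (ℕ; zero; suc; _∸_; _≤_; _<_; _≤′_; ≤′-refl; ≤′-step; s≤s; _%_; _/_; _<?_)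
  renaming (_+_ to _+ℕ_; _*_ to _*ℕ_)
import Data.Nat.Properties as ℕₚ
open import Data.Nat.DivMod using (m≡m%n+[m/n]*n; [m+kn]%n≡m%n; m*n%n≡0; m*n/n≡m; +-distrib-/-∣ˡ)
open import Data.Nat.Divisibility using (m∣m*n)
open import Data.List using (List; []; _∷_; _++_; length)
open import Data.Product using (_,_)
open import Data.Sum using (_⊎_; inj₁; inj₂)
open import Relation.Nullary using (¬_; yes; no)
open import Relation.Binary.Bundles using (Setoid)
open import Relation.Binary.PropositionalEquality as ≡ using (_≡_)
open import Algebra.Bundles using (CommutativeSemigroup)
import Algebra.Properties.CommutativeSemigroup as CommutativeSemigroupProperties
import Relation.Binary.Reasoning.Setoid as SetoidReasoning

data Parity : ℕ → Set where
  even : ∀ q → Parity (2 *ℕ q)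
  odd  : ∀ q → Parity (suc (2 *ℕ q))

parity : ∀ n → Parity n
parity zero = even 0
parity (suc n) with parity n
... | even q = odd q
... | odd q  = ≡.subst Parity (≡.cong suc (ℕₚ.+-suc q (q +ℕ 0))) (even (suc q))

[2*q]%2≡0 : ∀ q → 2 *ℕ q % 2 ≡ 0
[2*q]%2≡0 q = ≡.trans (≡.cong (_% 2) (ℕₚ.*-comm 2 q)) (m*n%n≡0 q 2)

[2*q]/2≡q : ∀ q → 2 *ℕ q / 2 ≡ q
[2*q]/2≡q q = ≡.trans (≡.cong (_/ 2) (ℕₚ.*-comm 2 q)) (m*n/n≡m q 2)

[2*q+j]%2≡j%2 : ∀ q j → (2 *ℕ q +ℕ j) % 2 ≡ j % 2
[2*q+j]%2≡j%2 q j = ≡.trans (≡.cong (_% 2) (ℕₚ.+-comm (2 *ℕ q) j))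
  (≡.trans (≡.cong (λ t → (j +ℕ t) % 2) (ℕₚ.*-comm 2 q)) ([m+kn]%n≡m%n j q 2))

[2*q+j]/2≡q+j/2 : ∀ q j → (2 *ℕ q +ℕ j) / 2 ≡ q +ℕ j / 2
[2*q+j]/2≡q+j/2 q j = ≡.trans (+-distrib-/-∣ˡ j (m∣m*n q)) (≡.cong (_+ℕ j / 2) ([2*q]/2≡q q))

[1+2*m]∸2*q≡1+2*[m∸q] : ∀ m q → 2 *ℕ q ≤ suc (2 *ℕ m) → suc (2 *ℕ m) ∸ 2 *ℕ q ≡ suc (2 *ℕ (m ∸ q))
[1+2*m]∸2*q≡1+2*[m∸q] m q 2q≤1+2m =
  ≡.trans (ℕₚ.+-∸-assoc 1 2q≤2m) (≡.cong suc (≡.sym (ℕₚ.*-distribˡ-∸ 2 m q)))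
  where
  2q≤2m : 2 *ℕ q ≤ 2 *ℕ m
  2q≤2m = ℕₚ.<⇒≤pred (ℕₚ.≤∧≢⇒< 2q≤1+2m (ℕₚ.even≢odd q m))

module PowerSeriesProperties {c ℓ : Level} (F : Field c ℓ) where
  open Field F
  open PowerSeries F
  open SetoidReasoning setoid
  open CommutativeSemigroupProperties +-commutativeSemigroup using () renaming (interchange to +-interchange)
  open CommutativeSemigroupProperties *-commutativeSemigroup using () renaming (interchange to *-interchange)

  *-nonzero : ∀ {a b} → ¬ (a ≈ 0#) → ¬ (b ≈ 0#) → ¬ (a * b ≈ 0#)
  *-nonzero {a} {b} a≉0 b≉0 ab≈0 = b≉0 (begin
    b                ≈⟨ sym (*-identityˡ b) ⟩
    1# * b           ≈⟨ *-congʳ (sym (trans (*-comm _ _) (⁻¹-inverse a a≉0))) ⟩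
    (a ⁻¹ * a) * b   ≈⟨ *-assoc _ _ _ ⟩
    a ⁻¹ * (a * b)   ≈⟨ *-congˡ ab≈0 ⟩
    a ⁻¹ * 0#        ≈⟨ zeroʳ _ ⟩
    0#               ∎)

  Σ<-cong-< : ∀ n {f g : ℕ → Carrier} → (∀ k → k < n → f k ≈ g k) → Σ< n f ≈ Σ< n g
  Σ<-cong-< zero    f≈g = refl
  Σ<-cong-< (suc n) f≈g =
    +-cong (Σ<-cong-< n (λ k k<n → f≈g k (ℕₚ.m<n⇒m<1+n k<n))) (f≈g n ℕₚ.≤-refl)

  Σ<-cong : ∀ n {f g : ℕ → Carrier} → (∀ k → f k ≈ g k) → Σ< n f ≈ Σ< n g
  Σ<-cong n f≈g = Σ<-cong-< n (λ k _ → f≈g k)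

  Σ<-zero : ∀ n {f : ℕ → Carrier} → (∀ k → k < n → f k ≈ 0#) → Σ< n f ≈ 0#
  Σ<-zero zero    f≈0 = refl
  Σ<-zero (suc n) f≈0 =
    trans (+-cong (Σ<-zero n (λ k k<n → f≈0 k (ℕₚ.m<n⇒m<1+n k<n))) (f≈0 n ℕₚ.≤-refl)) (+-identityˡ 0#)

  Σ<-+ : ∀ n {f g : ℕ → Carrier} → Σ< n (λ k → f k + g k) ≈ Σ< n f + Σ< n g
  Σ<-+ zero              = sym (+-identityˡ 0#)
  Σ<-+ (suc n) {f} {g} = trans (+-congʳ (Σ<-+ n)) (+-interchange (Σ< n f) (Σ< n g) (f n) (g n))

  *-distribˡ-Σ< : ∀ n a {f : ℕ → Carrier} → a * Σ< n f ≈ Σ< n (λ k → a * f k)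
  *-distribˡ-Σ< zero    a     = zeroʳ a
  *-distribˡ-Σ< (suc n) a {f} = trans (distribˡ a (Σ< n f) (f n)) (+-congʳ (*-distribˡ-Σ< n a))

  *-distribʳ-Σ< : ∀ n a {f : ℕ → Carrier} → Σ< n f * a ≈ Σ< n (λ k → f k * a)
  *-distribʳ-Σ< zero    a     = zeroˡ a
  *-distribʳ-Σ< (suc n) a {f} = trans (distribʳ a (Σ< n f) (f n)) (+-congʳ (*-distribʳ-Σ< n a))

  Σ<-comm : ∀ n m {G : ℕ → ℕ → Carrier} →
            Σ< n (λ i → Σ< m (λ j → G i j)) ≈ Σ< m (λ j → Σ< n (λ i → G i j))
  Σ<-comm zero    m = sym (Σ<-zero m (λ _ _ → refl))
  Σ<-comm (suc n) m = trans (+-congʳ (Σ<-comm n m)) (sym (Σ<-+ m))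

  Σ<-head : ∀ n {f : ℕ → Carrier} → Σ< (suc n) f ≈ f 0 + Σ< n (λ k → f (suc k))
  Σ<-head zero    {f} = +-comm 0# (f 0)
  Σ<-head (suc n) {f} = trans (+-congʳ (Σ<-head n)) (+-assoc (f 0) _ _)

  Σ<-reverse : ∀ n {f : ℕ → Carrier} → Σ< n f ≈ Σ< n (λ k → f (n ∸ suc k))
  Σ<-reverse zero        = refl
  Σ<-reverse (suc n) {f} = trans (+-congʳ (Σ<-reverse n)) (trans (+-comm _ _) (sym (Σ<-head n)))

  Σ<-extend : ∀ {m n} {f : ℕ → Carrier} → m ≤ n → (∀ k → m ≤ k → f k ≈ 0#) →
              Σ< n f ≈ Σ< m f
  Σ<-extend {m} {f = f} m≤n f≈0 = go (ℕₚ.≤⇒≤′ m≤n)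
    where
    go : ∀ {n} → m ≤′ n → Σ< n f ≈ Σ< m f
    go ≤′-refl          = refl
    go (≤′-step m≤′n) = trans (+-cong (go m≤′n) (f≈0 _ (ℕₚ.≤′⇒≤ m≤′n))) (+-identityʳ _)

  Σ<-triangle : ∀ n (G : ℕ → ℕ → Carrier) →
                Σ< (suc n) (λ k → Σ< (suc k) (λ i → G i (k ∸ i))) ≈
                Σ< (suc n) (λ i → Σ< (suc (n ∸ i)) (λ j → G i j))
  Σ<-triangle zero    G = refl
  Σ<-triangle (suc n) G = begin
      Σ< (suc n) (λ k → Σ< (suc k) (λ i → G i (k ∸ i))) + (Diagonal + G (suc n) (suc n ∸ suc n))
    ≈⟨ +-congʳ (Σ<-triangle n G) ⟩
      Rows + (Diagonal + G (suc n) (suc n ∸ suc n))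
    ≈⟨ sym (+-assoc Rows Diagonal _) ⟩
      (Rows + Diagonal) + G (suc n) (suc n ∸ suc n)
    ≈⟨ +-cong (sym (Σ<-+ (suc n))) (sym (lastRow n)) ⟩
      Σ< (suc n) (λ i → Σ< (suc (n ∸ i)) (G i) + G i (suc n ∸ i)) + Σ< (suc (suc n ∸ suc n)) (G (suc n))
    ≈⟨ +-congʳ (Σ<-cong-< (suc n) (λ i i<1+n → sym (extendRow i (ℕₚ.<⇒≤pred i<1+n)))) ⟩
      Σ< (suc n) (λ i → Σ< (suc (suc n ∸ i)) (G i)) + Σ< (suc (suc n ∸ suc n)) (G (suc n))
    ∎
    where
    Rows     = Σ< (suc n) (λ i → Σ< (suc (n ∸ i)) (λ j → G i j))
    Diagonal = Σ< (suc n) (λ i → G i (suc n ∸ i))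
    extendRow : ∀ i → i ≤ n → Σ< (suc (suc n ∸ i)) (G i) ≈ Σ< (suc (n ∸ i)) (G i) + G i (suc n ∸ i)
    extendRow i i≤n rewrite ℕₚ.+-∸-assoc 1 i≤n = refl
    lastRow : ∀ m → Σ< (suc (m ∸ m)) (G (suc n)) ≈ G (suc n) (m ∸ m)
    lastRow m rewrite ℕₚ.n∸n≡0 m = +-identityˡ _

  infix 4 _≋_
  _≋_ : Series → Series → Set ℓ
  a ≋ b = ∀ n → a n ≈ b n

  ≋-setoid : Setoid c ℓ
  ≋-setoid = record
    { Carrier       = Series
    ; _≈_           = _≋_
    ; isEquivalence = record
      { refl  = λ _ → refl
      ; sym   = λ a≋b n → sym (a≋b n)
      ; trans = λ a≋b b≋d n → trans (a≋b n) (b≋d n)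
      }
    }

  module ≋ = Setoid ≋-setoid

  ⊛-cong : ∀ {a a′ b b′} → a ≋ a′ → b ≋ b′ → a ⊛ b ≋ a′ ⊛ b′
  ⊛-cong a≋a′ b≋b′ n = Σ<-cong (suc n) (λ k → *-cong (a≋a′ k) (b≋b′ (n ∸ k)))

  ⊛-comm : ∀ a b → a ⊛ b ≋ b ⊛ a
  ⊛-comm a b n = trans (Σ<-reverse (suc n)) (Σ<-cong-< (suc n) λ k k<1+n →
    trans (*-comm _ _) (*-congʳ (reflexive (≡.cong b (ℕₚ.m∸[m∸n]≡n (ℕₚ.<⇒≤pred k<1+n))))))

  ⊛-identityˡ : ∀ a → one ⊛ a ≋ a
  ⊛-identityˡ a n =
    trans (Σ<-head n) (trans (+-cong (*-identityˡ (a n)) (Σ<-zero n (λ _ _ → zeroˡ _))) (+-identityʳ _))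

  ⊛-assoc : ∀ a b d → (a ⊛ b) ⊛ d ≋ a ⊛ (b ⊛ d)
  ⊛-assoc a b d n = begin
      Σ< (suc n) (λ k → Σ< (suc k) (λ i → a i * b (k ∸ i)) * d (n ∸ k))
    ≈⟨ Σ<-cong (suc n) (λ k → trans (*-distribʳ-Σ< (suc k) (d (n ∸ k)))
         (Σ<-cong-< (suc k) (λ i i<1+k → regroup k i (ℕₚ.<⇒≤pred i<1+k)))) ⟩
      Σ< (suc n) (λ k → Σ< (suc k) (λ i → G i (k ∸ i)))
    ≈⟨ Σ<-triangle n G ⟩
      Σ< (suc n) (λ i → Σ< (suc (n ∸ i)) (λ j → G i j))
    ≈⟨ Σ<-cong (suc n) (λ i → sym (trans (*-distribˡ-Σ< (suc (n ∸ i)) (a i))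
         (Σ<-cong (suc (n ∸ i)) (λ j → *-congˡ (*-congˡ (reflexive (≡.cong d (ℕₚ.∸-+-assoc n i j)))))))) ⟩
      Σ< (suc n) (λ i → a i * Σ< (suc (n ∸ i)) (λ j → b j * d ((n ∸ i) ∸ j)))
    ∎
    where
    G : ℕ → ℕ → Carrier
    G i j = a i * (b j * d (n ∸ (i +ℕ j)))
    regroup : ∀ k i → i ≤ k → (a i * b (k ∸ i)) * d (n ∸ k) ≈ G i (k ∸ i)
    regroup k i i≤k = trans (*-assoc _ _ _)
      (*-congˡ (*-congˡ (reflexive (≡.cong (λ t → d (n ∸ t)) (≡.sym (ℕₚ.m+[n∸m]≡n i≤k))))))

  ⊛-commutativeSemigroup : CommutativeSemigroup c ℓ
  ⊛-commutativeSemigroup = record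
    { Carrier                 = Series
    ; _≈_                     = _≋_
    ; _∙_                     = _⊛_
    ; isCommutativeSemigroup = record
      { isSemigroup = record
        { isMagma = record { isEquivalence = ≋.isEquivalence ; ∙-cong = ⊛-cong }
        ; assoc   = ⊛-assoc
        }
      ; comm = ⊛-comm
      }
    }

  open CommutativeSemigroupProperties ⊛-commutativeSemigroup
    using () renaming (x∙yz≈y∙xz to a⊛[b⊛d]≋b⊛[a⊛d])

  pow-+ : ∀ a p q → pow a (p +ℕ q) ≋ pow a p ⊛ pow a q
  pow-+ a zero    q = ≋.sym (⊛-identityˡ (pow a q))
  pow-+ a (suc p) q = ≋.trans (⊛-cong ≋.refl (pow-+ a p q)) (≋.sym (⊛-assoc a (pow a p) (pow a q)))

  X⊛-suc : ∀ a n → (X ⊛ a) (suc n) ≈ a n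
  X⊛-suc a n = begin
      (X ⊛ a) (suc n)
    ≈⟨ Σ<-head (suc n) ⟩
      0# * a (suc n) + Σ< (suc n) (λ k → X (suc k) * a (n ∸ k))
    ≈⟨ +-cong (zeroˡ _) (Σ<-head n) ⟩
      0# + (1# * a n + Σ< n (λ k → 0# * a (n ∸ suc k)))
    ≈⟨ +-identityˡ _ ⟩
      1# * a n + Σ< n (λ k → 0# * a (n ∸ suc k))
    ≈⟨ +-cong (*-identityˡ _) (Σ<-zero n (λ _ _ → zeroˡ _)) ⟩
      a n + 0#
    ≈⟨ +-identityʳ _ ⟩
      a n
    ∎

  HasOrder : ℕ → Series → Set ℓ
  HasOrder p a = ∀ m → m < p → a m ≈ 0#

  ⊛-order : ∀ p q {a b} → HasOrder p a → HasOrder q b → HasOrder (p +ℕ q) (a ⊛ b)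
  ⊛-order p q {a} {b} a-order b-order m m<p+q = Σ<-zero (suc m) term
    where
    term : ∀ k → k < suc m → a k * b (m ∸ k) ≈ 0#
    term k k<1+m with k <? p
    ... | yes k<p = trans (*-congʳ (a-order k k<p)) (zeroˡ _)
    ... | no  k≮p = trans (*-congˡ (b-order (m ∸ k) m∸k<q)) (zeroʳ _)
      where
      m∸k<q : m ∸ k < q
      m∸k<q = ℕₚ.+-cancelˡ-< k (m ∸ k) q
        (ℕₚ.≤-<-trans (ℕₚ.≤-reflexive (ℕₚ.m+[n∸m]≡n (ℕₚ.<⇒≤pred k<1+m)))
          (ℕₚ.<-≤-trans m<p+q (ℕₚ.+-monoˡ-≤ q (ℕₚ.≮⇒≥ k≮p))))

  pow-order : ∀ {p a} → HasOrder p a → ∀ k → HasOrder (k *ℕ p) (pow a k)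
  pow-order a-order zero        m ()
  pow-order {p} a-order (suc k) = ⊛-order p (k *ℕ p) a-order (pow-order a-order k)

  X⊛-order : ∀ {p a} → HasOrder p a → HasOrder (suc p) (X ⊛ a)
  X⊛-order a-order zero    _             = trans (+-identityˡ _) (zeroˡ _)
  X⊛-order {a = a} a-order (suc m) (s≤s m<p) = trans (X⊛-suc a m) (a-order m m<p)

  EvenSeries : Series → Set ℓ
  EvenSeries a = ∀ m → a (suc (2 *ℕ m)) ≈ 0#

  EvenSeries-resp : ∀ {a b} → a ≋ b → EvenSeries a → EvenSeries b
  EvenSeries-resp a≋b a-even m = trans (sym (a≋b _)) (a-even m)

  ⊛-even : ∀ {a b} → EvenSeries a → EvenSeries b → EvenSeries (a ⊛ b)
  ⊛-even {a} {b} a-even b-even m = Σ<-zero (suc (suc (2 *ℕ m))) term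
    where
    term : ∀ k → k < suc (suc (2 *ℕ m)) → a k * b (suc (2 *ℕ m) ∸ k) ≈ 0#
    term k k≤1+2m with parity k
    ... | odd q  = trans (*-congʳ (a-even q)) (zeroˡ _)
    ... | even q = trans (*-congˡ b-zero) (zeroʳ _)
      where
      b-zero : b (suc (2 *ℕ m) ∸ 2 *ℕ q) ≈ 0#
      b-zero rewrite [1+2*m]∸2*q≡1+2*[m∸q] m q (ℕₚ.<⇒≤pred k≤1+2m) = b-even (m ∸ q)

  pow-even : ∀ {a} → EvenSeries a → ∀ k → EvenSeries (pow a k)
  pow-even     a-even zero    m = refl
  pow-even {a} a-even (suc k) = ⊛-even {a} {pow a k} a-even (pow-even a-even k)

  X⊛-even : ∀ {a} → OddSeries a → EvenSeries (X ⊛ a)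
  X⊛-even {a} a-odd m = trans (X⊛-suc a (2 *ℕ m)) (a-odd m)

  length-++-∷ : ∀ (xs : List Carrier) {y} → length (xs ++ y ∷ []) ≡ suc (length xs)
  length-++-∷ []       = ≡.refl
  length-++-∷ (_ ∷ xs) = ≡.cong suc (length-++-∷ xs)

  nth-++ˡ : ∀ xs ys k → k < length xs → nth (xs ++ ys) k ≡ nth xs k
  nth-++ˡ (_ ∷ xs) ys zero    _         = ≡.refl
  nth-++ˡ (_ ∷ xs) ys (suc k) (s≤s k<) = nth-++ˡ xs ys k k<

  nth-length-++-∷ : ∀ xs y → nth (xs ++ y ∷ []) (length xs) ≡ y
  nth-length-++-∷ []       y = ≡.refl
  nth-length-++-∷ (_ ∷ xs) y = nth-length-++-∷ xs y

  module _ (N D : Series) where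

    length-divPrefix : ∀ n → length (divPrefix N D n) ≡ n
    length-divPrefix zero    = ≡.refl
    length-divPrefix (suc n) = ≡.trans (length-++-∷ (divPrefix N D n)) (≡.cong suc (length-divPrefix n))

    nth-divPrefix : ∀ n k → k < n → nth (divPrefix N D n) k ≡ (N ÷ D) k
    nth-divPrefix (suc n) k k<1+n with ℕₚ.m<1+n⇒m<n∨m≡n k<1+n
    ... | inj₁ k<n    = ≡.trans (nth-++ˡ (divPrefix N D n) _ k (≡.subst (k <_) (≡.sym (length-divPrefix n)) k<n))
                                 (nth-divPrefix n k k<n)
    ... | inj₂ ≡.refl = ≡.refl

    ÷-recurrence : ∀ n → (N ÷ D) n ≈ D 0 ⁻¹ * (N n - Σ< n (λ k → (N ÷ D) k * D (n ∸ k)))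
    ÷-recurrence n = trans (reflexive ÷≡next)
      (*-congˡ (+-congˡ (-‿cong (Σ<-cong-< n (λ k k<n → *-congʳ (reflexive (nth-divPrefix n k k<n)))))))
      where
      next : Carrier
      next = D 0 ⁻¹ * (N n - Σ< n (λ k → nth (divPrefix N D n) k * D (n ∸ k)))
      ÷≡next : (N ÷ D) n ≡ next
      ÷≡next = ≡.subst (λ t → nth (divPrefix N D n ++ next ∷ []) t ≡ next) (length-divPrefix n)
                       (nth-length-++-∷ (divPrefix N D n) next)

  ÷-unique : ∀ {N D Q} → ¬ (D 0 ≈ 0#) → N ≋ Q ⊛ D → N ÷ D ≋ Q
  ÷-unique {N} {D} {Q} D₀≉0 N≋QD n = below (suc n) n ℕₚ.≤-refl
    where
    step : ∀ n → (∀ k → k < n → (N ÷ D) k ≈ Q k) → (N ÷ D) n ≈ Q n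
    step n ih = begin
        (N ÷ D) n
      ≈⟨ ÷-recurrence N D n ⟩
        D 0 ⁻¹ * (N n - Σ< n (λ k → (N ÷ D) k * D (n ∸ k)))
      ≈⟨ *-congˡ (+-congˡ (-‿cong (Σ<-cong-< n (λ k k<n → *-congʳ (ih k k<n))))) ⟩
        D 0 ⁻¹ * (N n - Σ< n (λ k → Q k * D (n ∸ k)))
      ≈⟨ *-congˡ (+-congʳ (N≋QD n)) ⟩
        D 0 ⁻¹ * ((Σ< n (λ k → Q k * D (n ∸ k)) + Q n * D (n ∸ n)) - Σ< n (λ k → Q k * D (n ∸ k)))
      ≈⟨ *-congˡ (trans (+-congʳ (+-comm _ _)) (trans (+-assoc _ _ _)
           (trans (+-congˡ (-‿inverseʳ _)) (+-identityʳ _)))) ⟩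
        D 0 ⁻¹ * (Q n * D (n ∸ n))
      ≈⟨ *-congˡ (trans (*-comm _ _) (*-congʳ (reflexive (≡.cong D (ℕₚ.n∸n≡0 n))))) ⟩
        D 0 ⁻¹ * (D 0 * Q n)
      ≈⟨ sym (*-assoc _ _ _) ⟩
        (D 0 ⁻¹ * D 0) * Q n
      ≈⟨ *-congʳ (trans (*-comm _ _) (⁻¹-inverse (D 0) D₀≉0)) ⟩
        1# * Q n
      ≈⟨ *-identityˡ _ ⟩
        Q n
      ∎

    below : ∀ n k → k < n → (N ÷ D) k ≈ Q k
    below (suc n) k k<1+n with ℕₚ.m<1+n⇒m<n∨m≡n k<1+n
    ... | inj₁ k<n    = below n k k<n
    ... | inj₂ ≡.refl = step n (below n)

  -- act g f₁ f₂ is, by definition, columnAction (column g f₁ f₂).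
  columnAction : (ℕ → Series) → Series → Series
  columnAction d h n = Σ< (suc n) (λ k → d k n * h k)

  columnAction-cong : ∀ d {h h′} → h ≋ h′ → columnAction d h ≋ columnAction d h′
  columnAction-cong d h≋h′ n = Σ<-cong (suc n) (λ k → *-congˡ (h≋h′ k))

  columnAction-zero : ∀ d h → columnAction d h 0 ≈ d 0 0 * h 0
  columnAction-zero d h = +-identityˡ _

  columnAction-even : ∀ {d e} → (∀ i → e i ≈ 0# ⊎ EvenSeries (d i)) → EvenSeries (columnAction d e)
  columnAction-even {d} {e} vanishing m = Σ<-zero (suc (suc (2 *ℕ m))) term
    where
    term : ∀ i → i < suc (suc (2 *ℕ m)) → d i (suc (2 *ℕ m)) * e i ≈ 0#
    term i _ with vanishing i
    ... | inj₁ eᵢ≈0    = trans (*-congˡ eᵢ≈0) (zeroʳ _)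
    ... | inj₂ dᵢ-even = trans (*-congʳ (dᵢ-even m)) (zeroˡ _)

  module _ {cc dd : ℕ → Series}
           (cc-order : ∀ i → HasOrder i (cc i)) (dd-order : ∀ j → HasOrder j (dd j)) where

    columnAction-⊛-expand : ∀ e h n →
      (columnAction cc e ⊛ columnAction dd h) n ≈
      Σ< (suc n) (λ i → Σ< (suc n) (λ j → (e i * h j) * (cc i ⊛ dd j) n))
    columnAction-⊛-expand e h n = begin
        Σ< (suc n) (λ a → columnAction cc e a * columnAction dd h (n ∸ a))
      ≈⟨ Σ<-cong-< (suc n) (λ a a<1+n → *-cong (extend-cc a (ℕₚ.<⇒≤pred a<1+n)) (extend-dd a)) ⟩
        Σ< (suc n) (λ a → Σ< (suc n) (λ i → cc i a * e i) * Σ< (suc n) (λ j → dd j (n ∸ a) * h j))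
      ≈⟨ Σ<-cong (suc n) (λ a → trans (*-distribʳ-Σ< (suc n) _)
                                     (Σ<-cong (suc n) (λ i → *-distribˡ-Σ< (suc n) _))) ⟩
        Σ< (suc n) (λ a → Σ< (suc n) (λ i → Σ< (suc n) (λ j → T i j a)))
      ≈⟨ trans (Σ<-comm (suc n) (suc n)) (Σ<-cong (suc n) (λ i → Σ<-comm (suc n) (suc n))) ⟩
        Σ< (suc n) (λ i → Σ< (suc n) (λ j → Σ< (suc n) (λ a → T i j a)))
      ≈⟨ Σ<-cong (suc n) (λ i → Σ<-cong (suc n) (λ j → factor i j)) ⟩
        Σ< (suc n) (λ i → Σ< (suc n) (λ j → (e i * h j) * (cc i ⊛ dd j) n))
      ∎
      where
      T : ℕ → ℕ → ℕ → Carrier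
      T i j a = (cc i a * e i) * (dd j (n ∸ a) * h j)
      extend-cc : ∀ a → a ≤ n → columnAction cc e a ≈ Σ< (suc n) (λ i → cc i a * e i)
      extend-cc a a≤n = sym (Σ<-extend (s≤s a≤n) (λ i a<i → trans (*-congʳ (cc-order i a a<i)) (zeroˡ _)))
      extend-dd : ∀ a → columnAction dd h (n ∸ a) ≈ Σ< (suc n) (λ j → dd j (n ∸ a) * h j)
      extend-dd a = sym (Σ<-extend (s≤s (ℕₚ.m∸n≤m n a))
        (λ j n∸a<j → trans (*-congʳ (dd-order j (n ∸ a) n∸a<j)) (zeroˡ _)))
      factor : ∀ i j → Σ< (suc n) (T i j) ≈ (e i * h j) * (cc i ⊛ dd j) n
      factor i j = trans
        (Σ<-cong (suc n) (λ a → trans (*-interchange (cc i a) (e i) (dd j (n ∸ a)) (h j)) (*-comm _ _)))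
        (sym (*-distribˡ-Σ< (suc n) (e i * h j)))

    columnAction-⊛ : ∀ {e} → (∀ i → e i ≈ 0# ⊎ (∀ j → cc i ⊛ dd j ≋ dd (i +ℕ j))) →
      ∀ h → columnAction dd (e ⊛ h) ≋ columnAction cc e ⊛ columnAction dd h
    columnAction-⊛ {e} multiplicative h n = sym (begin
        (columnAction cc e ⊛ columnAction dd h) n
      ≈⟨ columnAction-⊛-expand e h n ⟩
        Σ< (suc n) (λ i → Σ< (suc n) (λ j → (e i * h j) * (cc i ⊛ dd j) n))
      ≈⟨ Σ<-cong (suc n) (λ i → Σ<-cong (suc n) (λ j → shift-column i j)) ⟩
        Σ< (suc n) (λ i → Σ< (suc n) (λ j → Term i j))
      ≈⟨ Σ<-cong (suc n) (λ i → Σ<-extend (s≤s (ℕₚ.m∸n≤m n i)) (λ j n∸i<j → vanish i j n∸i<j)) ⟩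
        Σ< (suc n) (λ i → Σ< (suc (n ∸ i)) (λ j → Term i j))
      ≈⟨ sym (Σ<-triangle n Term) ⟩
        Σ< (suc n) (λ k → Σ< (suc k) (λ i → Term i (k ∸ i)))
      ≈⟨ Σ<-cong (suc n) (λ k → trans (Σ<-cong-< (suc k) (λ i i<1+k → diagonal k i (ℕₚ.<⇒≤pred i<1+k)))
                                      (sym (*-distribˡ-Σ< (suc k) (dd k n)))) ⟩
        Σ< (suc n) (λ k → dd k n * (e ⊛ h) k)
      ∎)
      where
      Term : ℕ → ℕ → Carrier
      Term i j = (e i * h j) * dd (i +ℕ j) n
      shift-column : ∀ i j → (e i * h j) * (cc i ⊛ dd j) n ≈ Term i j
      shift-column i j with multiplicative i
      ... | inj₂ cc⊛dd≋dd = *-congˡ (cc⊛dd≋dd j n)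
      ... | inj₁ eᵢ≈0     = trans (*-congʳ eᵢh≈0) (trans (zeroˡ _) (sym (trans (*-congʳ eᵢh≈0) (zeroˡ _))))
        where
        eᵢh≈0 : e i * h j ≈ 0#
        eᵢh≈0 = trans (*-congʳ eᵢ≈0) (zeroˡ _)
      vanish : ∀ i j → n ∸ i < j → Term i j ≈ 0#
      vanish i j n∸i<j = trans (*-congˡ (dd-order (i +ℕ j) n n<i+j)) (zeroʳ _)
        where
        n<i+j : n < i +ℕ j
        n<i+j = ℕₚ.≤-<-trans (ℕₚ.m≤n+m∸n n i) (ℕₚ.+-monoʳ-< i n∸i<j)
      diagonal : ∀ k i → i ≤ k → Term i (k ∸ i) ≈ dd k n * (e i * h (k ∸ i))
      diagonal k i i≤k = trans (*-comm _ _) (*-congʳ (reflexive (≡.cong (λ t → dd t n) (ℕₚ.m+[n∸m]≡n i≤k))))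

  module Columns (f₁ f₂ : Series) where

    Y : Series
    Y = X ⊛ f₂

    column-order : ∀ g → HasOrder 1 f₁ → HasOrder 1 f₂ → ∀ k → HasOrder k (column g f₁ f₂ k)
    column-order g f₁-order f₂-order k =
      ≡.subst (λ t → HasOrder t (column g f₁ f₂ k)) 0+[k%2*1+k/2*2]≡k
        (⊛-order 0 _ (λ _ ()) (⊛-order (k % 2 *ℕ 1) _ (pow-order f₁-order (k % 2))
                                                       (pow-order (X⊛-order f₂-order) (k / 2))))
      where
      0+[k%2*1+k/2*2]≡k : 0 +ℕ (k % 2 *ℕ 1 +ℕ k / 2 *ℕ 2) ≡ k
      0+[k%2*1+k/2*2]≡k = ≡.trans (≡.cong (λ t → t +ℕ k / 2 *ℕ 2) (ℕₚ.*-identityʳ (k % 2)))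
                                  (≡.sym (m≡m%n+[m/n]*n k 2))

    act-zero : ∀ g h → act g f₁ f₂ h 0 ≈ g 0 * h 0
    act-zero g h = trans (columnAction-zero (column g f₁ f₂) h) (*-congʳ column-zero)
      where
      column-zero : column g f₁ f₂ 0 0 ≈ g 0
      column-zero = trans (+-identityˡ _)
        (trans (*-congˡ (trans (+-identityˡ _) (*-identityˡ 1#))) (*-identityʳ (g 0)))

    column-even-index : ∀ g q → column g f₁ f₂ (2 *ℕ q) ≋ g ⊛ pow Y q
    column-even-index g q = ≋.trans
      (≋.reflexive (≡.cong₂ (λ r s → g ⊛ (pow f₁ r ⊛ pow Y s)) ([2*q]%2≡0 q) ([2*q]/2≡q q)))
      (⊛-cong ≋.refl (⊛-identityˡ (pow Y q)))

    column-one-even-index : ∀ q → column one f₁ f₂ (2 *ℕ q) ≋ pow Y q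
    column-one-even-index q = ≋.trans (column-even-index one q) (⊛-identityˡ (pow Y q))

    pow-Y-⊛-column : ∀ g q j → pow Y q ⊛ column g f₁ f₂ j ≋ column g f₁ f₂ (2 *ℕ q +ℕ j)
    pow-Y-⊛-column g q j =
      ≋.trans (a⊛[b⊛d]≋b⊛[a⊛d] (pow Y q) g (pow f₁ (j % 2) ⊛ pow Y (j / 2)))
      (≋.trans (⊛-cong ≋.refl (a⊛[b⊛d]≋b⊛[a⊛d] (pow Y q) (pow f₁ (j % 2)) (pow Y (j / 2))))
      (≋.trans (⊛-cong ≋.refl (⊛-cong ≋.refl (≋.sym (pow-+ Y q (j / 2)))))
               (≋.reflexive (≡.cong₂ (λ r s → g ⊛ (pow f₁ r ⊛ pow Y s))
                                     (≡.sym ([2*q+j]%2≡j%2 q j)) (≡.sym ([2*q+j]/2≡q+j/2 q j))))))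

    act-⊛-even : ∀ g → HasOrder 1 f₁ → HasOrder 1 f₂ → ∀ {e} → EvenSeries e → ∀ h →
      act g f₁ f₂ (e ⊛ h) ≋ act one f₁ f₂ e ⊛ act g f₁ f₂ h
    act-⊛-even g f₁-order f₂-order {e} e-even =
      columnAction-⊛ (column-order one f₁-order f₂-order) (column-order g f₁-order f₂-order) multiplicative
      where
      multiplicative : ∀ i → e i ≈ 0# ⊎
                       (∀ j → column one f₁ f₂ i ⊛ column g f₁ f₂ j ≋ column g f₁ f₂ (i +ℕ j))
      multiplicative i with parity i
      ... | odd q  = inj₁ (e-even q)
      ... | even q = inj₂ λ j →
        ≋.trans (⊛-cong (column-one-even-index q) (≋.refl {column g f₁ f₂ j})) (pow-Y-⊛-column g q j)

    act-one-even : OddSeries f₂ → ∀ {e} → EvenSeries e → EvenSeries (act one f₁ f₂ e)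
    act-one-even f₂-odd {e} e-even = columnAction-even {column one f₁ f₂} {e} vanishing
      where
      vanishing : ∀ i → e i ≈ 0# ⊎ EvenSeries (column one f₁ f₂ i)
      vanishing i with parity i
      ... | odd q  = inj₁ (e-even q)
      ... | even q = inj₂ (EvenSeries-resp {pow Y q} (≋.sym (column-one-even-index q))
                                           (pow-even (X⊛-even {f₂} f₂-odd) q))

mainTheorem5 : ∀ {c ℓ : Level} (F : Field c ℓ) → CharZero F →
    let open PowerSeries F in
    (g f₁ f₂ u v₁ v₂ : Series) →
    IsSprugnoli g f₁ f₂ → IsSprugnoli u v₁ v₂ →
    OddSeries (shift (act g f₁ f₂ (X ⊛ (u ⊛ v₂)) ÷ act g f₁ f₂ u))
-- The characteristic is irrelevant: the argument works over any field.
mainTheorem5 F _ g f₁ f₂ u v₁ v₂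
  ((_ , g₀≉0) , (f₁-order , _) , (f₂-order , _) , f₂-odd) ((_ , u₀≉0) , _ , _ , v₂-odd) m =
  trans (÷-unique D₀≉0 numerator-factorises (suc (2 *ℕ m))) (act-one-even f₂-odd xv₂-even m)
  where
  open Field F
  open PowerSeries F
  open PowerSeriesProperties F
  open Columns f₁ f₂

  xv₂-even : EvenSeries (X ⊛ v₂)
  xv₂-even = X⊛-even {v₂} v₂-odd

  D₀≉0 : ¬ (act g f₁ f₂ u 0 ≈ 0#)
  D₀≉0 D₀≈0 = *-nonzero g₀≉0 u₀≉0 (trans (sym (act-zero g u)) D₀≈0)

  numerator-factorises : act g f₁ f₂ (X ⊛ (u ⊛ v₂)) ≋ act one f₁ f₂ (X ⊛ v₂) ⊛ act g f₁ f₂ u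
  numerator-factorises = ≋.trans
    (columnAction-cong (column g f₁ f₂) (≋.trans (⊛-cong ≋.refl (⊛-comm u v₂)) (≋.sym (⊛-assoc X v₂ u))))
    (act-⊛-even g f₁-order f₂-order xv₂-even u)
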